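{- Let $q$ be an odd prime power such that $-1$ is a square in $\mathbb{F}=\mathbb{F}_q$. Then $S_{01}^{00}=S_{01}^{10}=\emptyset$, and for $(x,y)\in S$: \begin{itemize} \item $(x,y)\in S_{00}^{00}$ if and only if $(1-x)(y-x)$ and $(1-y)(y-x)$ are squares; \item $(x,y)\in S_{00}^{11}$ if and only if $(x^2y+xy-x^2-y^2)(y-x)$ and $(xy^2+xy-x^2-y^2)(y-x)$ are nonsquares. \end{itemize}
   Context: A square is an element $z^2$, $z\in\mathbb{F}$; a nonsquare is an element that is not a square. $\Sigma$ is the set of $(a,b)\in\mathbb{F}^2$ with $a\ne b$, $a,b\notin\{0,1\}$ and $ab$, $(1-a)(1-b)$ squares. $S$ is the set of $(x,y)\in\mathbb{F}^2$ with $x,y$ squares, $x\ne y$, $\{x,y\}\cap\{0,1\}=\emptyset$. $\Psi:\Sigma\to S$ is $\Psi(a,b)=(a/b,(1-a)/(1-b))$. For $(a,b)\in\Sigma$ let $\psi=\psi_{a,b}$, $\psi(u)=au$ if $u$ is a square and $\psi(u)=bu$ if $u$ is a nonsquare. Let $E(a,b)$ be the set of $(u,v)\in\mathbb{F}^2\setminus\{(0,0)\}$ with $\psi(\psi(u)-v)=\psi(-v)+\psi(u-v-\psi(-v))$. For $i,j,r,s\in\{0,1\}$, $E_{ij}^{rs}(a,b)$ is the set of $(u,v)\in E(a,b)$ such that: $i=0$ iff $u$ is a square; $j=0$ iff $-v$ is a square; $r=0$ iff $\psi(u)-v$ is a square; $s=0$ iff $u-v-\psi(-v)$ is a square. $\Sigma_{ij}^{rs}=\{(a,b)\in\Sigma:E_{ij}^{rs}(a,b)\ne\emptyset\}$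 and $S_{ij}^{rs}=\Psi(\Sigma_{ij}^{rs})$. -}

module Defs where

open import Level using (Level; suc; _⊔_)
open import Data.Product using (Σ; ∃; _×_; _,_; proj₁; proj₂)
open import Data.Sum using (_⊎_)
open import Data.List using (List)
open import Data.List.Membership.Propositional using (_∈_)
open import Data.List.Relation.Unary.Any using (any?)
open import Data.List.Membership.Propositional.Properties using (∈-map⁺)
open import Relation.Nullary using (¬_; Dec; yes; no)
open import Relation.Nullary.Decidable using (map′)
open import Relation.Binary.PropositionalEquality using (_≡_; _≢_; refl; sym; subst)
open import Relation.Binary.Definitions using (DecidableEquality)
open import Algebra.Structures using (IsCommutativeRing)

-- The field F_q with q an odd
-- prime power is, up to isomorphism, exactly a finite field of characteristic
-- different from 2, i.e. one in which 1 + 1 ≠ 0.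
record FiniteField (c : Level) : Set (suc c) where
  infixl 6 _+_ _-_
  infixl 7 _*_
  infix  8 -_
  field
    Carrier : Set c
    _+_ _*_ : Carrier → Carrier → Carrier
    -_      : Carrier → Carrier
    0# 1#   : Carrier
    _⁻¹     : Carrier → Carrier
    isCommutativeRing : IsCommutativeRing _≡_ _+_ _*_ -_ 0# 1#
    0≢1     : 0# ≢ 1#
    ⁻¹-inverse : ∀ x → x ≢ 0# → x * (x ⁻¹) ≡ 1#
    _≟_     : DecidableEquality Carrier
    elements : List Carrier
    complete : ∀ x → x ∈ elements

  _-_ : Carrier → Carrier → Carrier
  x - y = x + (- y)

  _/_ : Carrier → Carrier → Carrier
  x / y = x * (y ⁻¹)

  IsSquare : Carrier → Set c
  IsSquare x = ∃ λ z → z * z ≡ x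

  IsNonsquare : Carrier → Set c
  IsNonsquare x = ¬ IsSquare x

  isSquare? : ∀ x → Dec (IsSquare x)
  isSquare? x with any? (λ z → (z * z) ≟ x) elements
  ... | yes p = yes (find p)
    where
    open import Data.List.Relation.Unary.Any using (Any; here; there)
    find : ∀ {xs} → Any (λ z → z * z ≡ x) xs → IsSquare x
    find (here e) = _ , e
    find (there q) = find q
  ... | no ¬p = no λ { (z , e) → ¬p (lift z e (complete z)) }
    where
    open import Data.List.Relation.Unary.Any using (Any; here; there)
    lift : ∀ {xs} z → z * z ≡ x → z ∈ xs → Any (λ w → w * w ≡ x) xs
    lift z e (here refl) = here e
    lift z e (there m) = there (lift z e m)

  OddChar : Set c
  OddChar = 1# + 1# ≢ 0#

  record InΣ (a b : Carrier) : Set c where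
    field
      a≢b  : a ≢ b
      a≢0  : a ≢ 0#
      a≢1  : a ≢ 1#
      b≢0  : b ≢ 0#
      b≢1  : b ≢ 1#
      ab-sq : IsSquare (a * b)
      1-a1-b-sq : IsSquare ((1# - a) * (1# - b))

  record InS (x y : Carrier) : Set c where
    field
      x-sq : IsSquare x
      y-sq : IsSquare y
      x≢y  : x ≢ y
      x≢0  : x ≢ 0#
      x≢1  : x ≢ 1#
      y≢0  : y ≢ 0#
      y≢1  : y ≢ 1#

  Ψ : Carrier × Carrier → Carrier × Carrier
  Ψ (a , b) = (a / b , (1# - a) / (1# - b))

  ψ : Carrier → Carrier → Carrier → Carrier
  ψ a b u with isSquare? u
  ... | yes _ = a * u
  ... | no  _ = b * u

  InE : Carrier → Carrier → Carrier → Carrier → Set c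
  InE a b u v =
    ¬ (u ≡ 0# × v ≡ 0#) ×
    ψ a b (ψ a b u - v) ≡ ψ a b (- v) + ψ a b (u - v - ψ a b (- v))

data Bit : Set where
  b0 b1 : Bit

module _ {c} (F : FiniteField c) where
  open FiniteField F

  SqIdx : Bit → Carrier → Set c
  SqIdx b0 t = IsSquare t
  SqIdx b1 t = IsNonsquare t

  InEijrs : Bit → Bit → Bit → Bit → Carrier → Carrier → Carrier → Carrier → Set c
  InEijrs i j r s a b u v =
    InE a b u v ×
    SqIdx i u ×
    SqIdx j (- v) ×
    SqIdx r (ψ a b u - v) ×
    SqIdx s (u - v - ψ a b (- v))

  InΣijrs : Bit → Bit → Bit → Bit → Carrier → Carrier → Set c
  InΣijrs i j r s a b = InΣ a b × ∃ λ u → ∃ λ v → InEijrs i j r s a b u v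

  InSijrs : Bit → Bit → Bit → Bit → Carrier → Carrier → Set c
  InSijrs i j r s x y =
    ∃ λ a → ∃ λ b → InΣijrs i j r s a b × Ψ (a , b) ≡ (x , y)

-- On E_{ij}^{rs}(a,b) the map ψ multiplies each of its four arguments by a or
-- by b, as prescribed by i, j, r, s, so the defining equation of E becomes a
-- polynomial identity in u and v.  For the patterns (01,00) and (01,10) it
-- forces a u = b v, resp. u = v, and either way -v is a square, contradicting
-- j = 1.  For (00,00) it forces u = v, after which the sign conditions say
-- exactly that a and a - 1 are squares.  Ψ is injective on Σ, with inverse
-- (x , y) ↦ (x b , b) where b = (y - 1)/(y - x); under this substitution
-- (1 - y)(y - x) · a and (1 - x)(y - x) · (a - 1) are nonzero squares.  For
-- (00,11) the equation forces x v = y u, and then ψ(u) - v and u - v - ψ(-v)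
-- are, up to nonzero square factors, u (x²y + xy - x² - y²)(y - x) and
-- u (xy² + xy - x² - y²)(y - x).
module Submission where

open import Defs
open import Level using (Level)
open import Data.Product using (_×_)
open import Relation.Nullary using (¬_)
open import Function.Bundles using (_⇔_)

open import Algebra.Bundles using (CommutativeRing)
open import Algebra.Solver.Ring.AlmostCommutativeRing
  using (fromCommutativeRing; _-Raw-AlmostCommutative⟶_)
open import Data.Integer as ℤ using (ℤ; +_; -[1+_]; _⊖_; 0ℤ; 1ℤ)
import Data.Integer.Properties as ℤP
open import Data.Maybe using (Maybe; just; nothing)
open import Data.Nat as ℕ using (zero; suc)
import Data.Nat.Properties as ℕP
open import Data.Product using (_,_; ∃₂; proj₁; proj₂)
open import Data.Product.Function.NonDependent.Propositional using (_×-⇔_)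
import Data.Sign as Sign
open import Function.Bundles using (mk⇔; Equivalence)
open import Function.Properties.Equivalence using ()
  renaming (sym to ⇔-sym; trans to ⇔-trans)
open import Function.Related.TypeIsomorphisms using (¬-cong-⇔)
open import Relation.Nullary using (yes; no; contradiction)
open import Relation.Binary.PropositionalEquality using (_≡_; _≢_)

-- Solving with integer coefficients rather than the ring's own elements makes
-- the solver's arithmetic on constants compute, so that its proofs are refl.
module IntegerCoefficients {c ℓ} (R : CommutativeRing c ℓ) where
  open CommutativeRing R
  open import Algebra.Properties.Ring ring using (-‿distribˡ-*; -‿distribʳ-*)
  open import Algebra.Properties.AbelianGroup +-abelianGroup using (⁻¹-∙-comm)
  open import Algebra.Properties.Group +-group using (⁻¹-involutive; ε⁻¹≈ε)
  open import Algebra.Properties.Monoid.Mult.TCOptimised +-monoid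
    using (1+×; ×-homo-+) renaming (_×_ to _·_)
  open import Algebra.Properties.Semiring.Mult.TCOptimised semiring using (×1-homo-*)
  open import Relation.Binary.Reasoning.Setoid setoid
  import Relation.Binary.PropositionalEquality as ≡

  fromℤ : ℤ → Carrier
  fromℤ (+ n)    = n · 1#
  fromℤ -[1+ n ] = - (suc n · 1#)

  fromℤ-homo-neg : ∀ i → fromℤ (ℤ.- i) ≈ - fromℤ i
  fromℤ-homo-neg (+ zero)  = sym ε⁻¹≈ε
  fromℤ-homo-neg (+ suc n) = refl
  fromℤ-homo-neg -[1+ n ]  = sym (⁻¹-involutive _)

  [1+x]-[1+y]≈x-y : ∀ x y → (1# + x) + - (1# + y) ≈ x + - y
  [1+x]-[1+y]≈x-y x y = begin
    (1# + x) + - (1# + y)    ≈⟨ +-cong (+-comm x 1#) (⁻¹-∙-comm 1# y) ⟨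
    (x + 1#) + (- 1# + - y)  ≈⟨ +-assoc x 1# _ ⟩
    x + (1# + (- 1# + - y))  ≈⟨ +-congˡ (+-assoc 1# (- 1#) (- y)) ⟨
    x + ((1# + - 1#) + - y)  ≈⟨ +-congˡ (+-congʳ (-‿inverseʳ 1#)) ⟩
    x + (0# + - y)           ≈⟨ +-congˡ (+-identityˡ _) ⟩
    x + - y                  ∎

  fromℤ-homo-⊖ : ∀ m n → fromℤ (m ⊖ n) ≈ m · 1# + - (n · 1#)
  fromℤ-homo-⊖ m       zero    = sym (trans (+-congˡ ε⁻¹≈ε) (+-identityʳ _))
  fromℤ-homo-⊖ zero    (suc n) = sym (+-identityˡ _)
  fromℤ-homo-⊖ (suc m) (suc n) = begin
    fromℤ (suc m ⊖ suc n)            ≡⟨ ≡.cong fromℤ (ℤP.[1+m]⊖[1+n]≡m⊖n m n) ⟩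
    fromℤ (m ⊖ n)                    ≈⟨ fromℤ-homo-⊖ m n ⟩
    m · 1# + - (n · 1#)              ≈⟨ [1+x]-[1+y]≈x-y _ _ ⟨
    (1# + m · 1#) + - (1# + n · 1#)  ≈⟨ +-cong (1+× m 1#) (-‿cong (1+× n 1#)) ⟨
    suc m · 1# + - (suc n · 1#)      ∎

  fromℤ-homo-+ : ∀ i j → fromℤ (i ℤ.+ j) ≈ fromℤ i + fromℤ j
  fromℤ-homo-+ (+ m)    (+ n)    = ×-homo-+ 1# m n
  fromℤ-homo-+ (+ m)    -[1+ n ] = fromℤ-homo-⊖ m (suc n)
  fromℤ-homo-+ -[1+ m ] (+ n)    = trans (fromℤ-homo-⊖ n (suc m)) (+-comm _ _)
  fromℤ-homo-+ -[1+ m ] -[1+ n ] = begin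
    - (suc (suc (m ℕ.+ n)) · 1#)     ≡⟨ ≡.cong (λ k → - (k · 1#)) (ℕP.+-suc (suc m) n) ⟨
    - ((suc m ℕ.+ suc n) · 1#)       ≈⟨ -‿cong (×-homo-+ 1# (suc m) (suc n)) ⟩
    - (suc m · 1# + suc n · 1#)      ≈⟨ ⁻¹-∙-comm _ _ ⟨
    - (suc m · 1#) + - (suc n · 1#)  ∎

  fromℤ-◃ : ∀ n → fromℤ (Sign.- ℤ.◃ n) ≈ - (n · 1#)
  fromℤ-◃ n = trans (reflexive (≡.cong fromℤ (ℤP.-◃n≡-n n))) (fromℤ-homo-neg (+ n))

  fromℤ-homo-* : ∀ i j → fromℤ (i ℤ.* j) ≈ fromℤ i * fromℤ j
  fromℤ-homo-* (+ m)    (+ n)    =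
    trans (reflexive (≡.cong fromℤ (ℤP.+◃n≡+n (m ℕ.* n)))) (×1-homo-* m n)
  fromℤ-homo-* (+ m)    -[1+ n ] =
    trans (fromℤ-◃ (m ℕ.* suc n)) (trans (-‿cong (×1-homo-* m (suc n))) (-‿distribʳ-* _ _))
  fromℤ-homo-* -[1+ m ] (+ n)    =
    trans (fromℤ-◃ (suc m ℕ.* n)) (trans (-‿cong (×1-homo-* (suc m) n)) (-‿distribˡ-* _ _))
  fromℤ-homo-* -[1+ m ] -[1+ n ] = begin
    (suc m ℕ.* suc n) · 1#           ≈⟨ ×1-homo-* (suc m) (suc n) ⟩
    suc m · 1# * suc n · 1#          ≈⟨ ⁻¹-involutive _ ⟨
    - - (suc m · 1# * suc n · 1#)    ≈⟨ -‿cong (-‿distribˡ-* _ _) ⟩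
    - (- (suc m · 1#) * suc n · 1#)  ≈⟨ -‿distribʳ-* _ _ ⟩
    - (suc m · 1#) * - (suc n · 1#)  ∎

  fromℤ-homomorphism : ℤ.+-*-rawRing -Raw-AlmostCommutative⟶ fromCommutativeRing R
  fromℤ-homomorphism = record
    { ⟦_⟧    = fromℤ
    ; +-homo = fromℤ-homo-+
    ; *-homo = fromℤ-homo-*
    ; -‿homo = fromℤ-homo-neg
    ; 0-homo = refl
    ; 1-homo = refl
    }

  fromℤ-≟ : ∀ i j → Maybe (fromℤ i ≈ fromℤ j)
  fromℤ-≟ i j with i ℤ.≟ j
  ... | yes ≡.refl = just refl
  ... | no _       = nothing

  open import Algebra.Solver.Ring ℤ.+-*-rawRing (fromCommutativeRing R)
    fromℤ-homomorphism fromℤ-≟ public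
    using (Polynomial; solve; _:=_; con; _:+_; _:*_; _:-_; :-_)

  :0 :1 : ∀ {n} → Polynomial n
  :0 = con 0ℤ
  :1 = con 1ℤ

module _ {c : Level} (F : FiniteField c) where
  open FiniteField F

  commutativeRing : CommutativeRing c c
  commutativeRing = record { isCommutativeRing = isCommutativeRing }

  open CommutativeRing commutativeRing
    using (+-identityˡ; *-identityˡ; *-identityʳ; *-assoc; *-comm; zeroˡ; zeroʳ; -‿inverseʳ)
  open IntegerCoefficients commutativeRing
  open import Relation.Binary.PropositionalEquality
    using (refl; sym; trans; cong; cong₂; subst; module ≡-Reasoning)
  open Equivalence using (to; from)
  open ≡-Reasoning

  1≢0 : 1# ≢ 0#
  1≢0 1≡0 = 0≢1 (sym 1≡0)

  x-y≡0⇒x≡y : ∀ {x y} → x - y ≡ 0# → x ≡ y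
  x-y≡0⇒x≡y {x} {y} x-y≡0 = begin
    x          ≡⟨ solve 2 (λ x y → x := x :- y :+ y) refl x y ⟩
    x - y + y  ≡⟨ cong (_+ y) x-y≡0 ⟩
    0# + y     ≡⟨ +-identityˡ y ⟩
    y          ∎

  x≢y⇒x-y≢0 : ∀ {x y} → x ≢ y → x - y ≢ 0#
  x≢y⇒x-y≢0 x≢y x-y≡0 = x≢y (x-y≡0⇒x≡y x-y≡0)

  x*y/y≡x : ∀ {y} x → y ≢ 0# → (x * y) / y ≡ x
  x*y/y≡x {y} x y≢0 = begin
    x * y * y ⁻¹    ≡⟨ *-assoc x y (y ⁻¹) ⟩
    x * (y * y ⁻¹)  ≡⟨ cong (x *_) (⁻¹-inverse y y≢0) ⟩
    x * 1#          ≡⟨ *-identityʳ x ⟩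
    x               ∎

  x/y*y≡x : ∀ {y} x → y ≢ 0# → x / y * y ≡ x
  x/y*y≡x {y} x y≢0 = begin
    x * y ⁻¹ * y    ≡⟨ solve 3 (λ x y y⁻¹ → x :* y⁻¹ :* y := x :* y :* y⁻¹) refl x y (y ⁻¹) ⟩
    x * y * y ⁻¹    ≡⟨ x*y/y≡x x y≢0 ⟩
    x               ∎

  x*y≡0⇒y≡0 : ∀ {x y} → x ≢ 0# → x * y ≡ 0# → y ≡ 0#
  x*y≡0⇒y≡0 {x} {y} x≢0 x*y≡0 = begin
    y             ≡⟨ x*y/y≡x y x≢0 ⟨
    (y * x) / x   ≡⟨ cong (_/ x) (*-comm y x) ⟩
    (x * y) / x   ≡⟨ cong (_/ x) x*y≡0 ⟩
    0# / x        ≡⟨ zeroˡ _ ⟩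
    0#            ∎

  *-≢0 : ∀ {x y} → x ≢ 0# → y ≢ 0# → x * y ≢ 0#
  *-≢0 x≢0 y≢0 x*y≡0 = y≢0 (x*y≡0⇒y≡0 x≢0 x*y≡0)

  -1≢0 : - 1# ≢ 0#
  -1≢0 -1≡0 = 1≢0 (begin
    1#              ≡⟨ solve 0 (:1 := :- :1 :* :- :1) refl ⟩
    - 1# * - 1#     ≡⟨ cong (_* - 1#) -1≡0 ⟩
    0# * - 1#       ≡⟨ zeroˡ _ ⟩
    0#              ∎)

  -- The ring solver cannot use hypotheses: an equation C ≡ D is instead
  -- derived from hypotheses A ≡ B by exhibiting C - D as a combination of
  -- the differences A - B, which the solver then checks.
  linear-combination₁ : ∀ {A B C D} k → A ≡ B → C - D ≡ k * (A - B) → C ≡ D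
  linear-combination₁ {A} k refl C-D≡ = x-y≡0⇒x≡y (begin
    _               ≡⟨ C-D≡ ⟩
    k * (A - A)     ≡⟨ solve 2 (λ k A → k :* (A :- A) := :0) refl k A ⟩
    0#              ∎)

  linear-combination₂ : ∀ {A B A′ B′ C D} k l → A ≡ B → A′ ≡ B′ →
    C - D ≡ k * (A - B) + l * (A′ - B′) → C ≡ D
  linear-combination₂ {A} {_} {A′} k l refl refl C-D≡ = x-y≡0⇒x≡y (begin
    _                             ≡⟨ C-D≡ ⟩
    k * (A - A) + l * (A′ - A′)   ≡⟨ solve 4 (λ k l A A′ →
                                       k :* (A :- A) :+ l :* (A′ :- A′) := :0) refl k l A A′ ⟩
    0#                            ∎)

  square-* : ∀ {x y} → IsSquare x → IsSquare y → IsSquare (x * y)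
  square-* (s , refl) (t , refl) =
    s * t , solve 2 (λ s t → (s :* t) :* (s :* t) := (s :* s) :* (t :* t)) refl s t

  square-1 : IsSquare 1#
  square-1 = 1# , *-identityʳ 1#

  square-⁻¹ : ∀ {x} → IsSquare x → x ≢ 0# → IsSquare (x ⁻¹)
  square-⁻¹ {x} x-square x≢0 = subst IsSquare x*x⁻¹² (square-* x-square (x ⁻¹ , refl))
    where
    x*x⁻¹² : x * (x ⁻¹ * x ⁻¹) ≡ x ⁻¹
    x*x⁻¹² = begin
      x * (x ⁻¹ * x ⁻¹)  ≡⟨ *-assoc x (x ⁻¹) (x ⁻¹) ⟨
      x * x ⁻¹ * x ⁻¹    ≡⟨ cong (_* x ⁻¹) (⁻¹-inverse x x≢0) ⟩
      1# * x ⁻¹          ≡⟨ *-identityˡ (x ⁻¹) ⟩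
      x ⁻¹               ∎

  square-*⇔ : ∀ {k z} → IsSquare k → k ≢ 0# → IsSquare (k * z) ⇔ IsSquare z
  square-*⇔ {_} {z} (t , refl) t²≢0 = mk⇔ cancel (square-* (t , refl))
    where
    t≢0 : t ≢ 0#
    t≢0 t≡0 = t²≢0 (trans (cong (_* t) t≡0) (zeroˡ t))
    cancel : IsSquare (t * t * z) → IsSquare z
    cancel (r , r²≡t²z) = r / t , (begin
      r * t ⁻¹ * (r * t ⁻¹)        ≡⟨ solve 2 (λ r t⁻¹ → r :* t⁻¹ :* (r :* t⁻¹)
                                        := r :* r :* (t⁻¹ :* t⁻¹)) refl r (t ⁻¹) ⟩
      r * r * (t ⁻¹ * t ⁻¹)        ≡⟨ cong (_* (t ⁻¹ * t ⁻¹)) r²≡t²z ⟩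
      t * t * z * (t ⁻¹ * t ⁻¹)    ≡⟨ solve 3 (λ t z t⁻¹ → t :* t :* z :* (t⁻¹ :* t⁻¹)
                                        := z :* (t :* t⁻¹) :* (t :* t⁻¹)) refl t z (t ⁻¹) ⟩
      z * (t * t ⁻¹) * (t * t ⁻¹)  ≡⟨ cong (λ e → z * e * e) (⁻¹-inverse t t≢0) ⟩
      z * 1# * 1#                  ≡⟨ solve 1 (λ z → z :* :1 :* :1 := z) refl z ⟩
      z                            ∎)

  square-factors⇔ : ∀ {x y z} → x * y ≡ z → IsSquare z → z ≢ 0# → IsSquare x ⇔ IsSquare y
  square-factors⇔ {x} {y} x*y≡z z-square z≢0 = mk⇔
    (λ x-square → to (square-*⇔ x-square x≢0) (subst IsSquare (sym x*y≡z) z-square))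
    (λ y-square → to (square-*⇔ y-square y≢0)
                    (subst IsSquare (sym (trans (*-comm y x) x*y≡z)) z-square))
    where
    x≢0 : x ≢ 0#
    x≢0 x≡0 = z≢0 (trans (sym x*y≡z) (trans (cong (_* y) x≡0) (zeroˡ y)))
    y≢0 : y ≢ 0#
    y≢0 y≡0 = z≢0 (trans (sym x*y≡z) (trans (cong (x *_) y≡0) (zeroʳ x)))

  square-scaled⇔ : ∀ {k l p q} → k * p ≡ l * q →
    IsSquare k → k ≢ 0# → IsSquare l → l ≢ 0# → IsSquare p ⇔ IsSquare q
  square-scaled⇔ k*p≡l*q k-square k≢0 l-square l≢0 =
    ⇔-trans (⇔-sym (square-*⇔ k-square k≢0))
      (⇔-trans (mk⇔ (subst IsSquare k*p≡l*q) (subst IsSquare (sym k*p≡l*q)))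
        (square-*⇔ l-square l≢0))

  multiplier : Bit → Carrier → Carrier → Carrier
  multiplier b0 a _ = a
  multiplier b1 _ b = b

  ψ-multiplier : ∀ {a b w} i → SqIdx F i w → ψ a b w ≡ multiplier i a b * w
  ψ-multiplier {w = w} b0 w-square with isSquare? w
  ... | yes _            = refl
  ... | no w-nonsquare   = contradiction w-square w-nonsquare
  ψ-multiplier {w = w} b1 w-nonsquare with isSquare? w
  ... | yes w-square     = contradiction w-square w-nonsquare
  ... | no _             = refl

  InLinEijrs : Bit → Bit → Bit → Bit → Carrier → Carrier → Carrier → Carrier → Set c
  InLinEijrs i j r s a b u v =
    ¬ (u ≡ 0# × v ≡ 0#) ×
    SqIdx F i u × SqIdx F j (- v) ×
    SqIdx F r (μ i * u - v) × SqIdx F s (u - v - μ j * (- v)) ×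
    μ r * (μ i * u - v) ≡ μ j * (- v) + μ s * (u - v - μ j * (- v))
    where
    μ : Bit → Carrier
    μ k = multiplier k a b

  InEijrs⇔InLinEijrs : ∀ {i j r s a b u v} →
    InEijrs F i j r s a b u v ⇔ InLinEijrs i j r s a b u v
  InEijrs⇔InLinEijrs {i} {j} {r} {s} {a} {b} {u} {v} = mk⇔
    (λ { ((nz , eq) , su , sv , sw , st) →
         nz , su , sv , subst (SqIdx F r) (cong (_- v) (ψu su)) sw
            , subst (SqIdx F s) (cong (λ z → u - v - z) (ψv sv)) st
            , to (linearise su sv sw st) eq })
    (λ { (nz , su , sv , sw , st , eq) →
         let sw′ : SqIdx F r (ψ a b u - v)
             sw′ = subst (SqIdx F r) (cong (_- v) (sym (ψu su))) sw
             st′ : SqIdx F s (u - v - ψ a b (- v))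
             st′ = subst (SqIdx F s) (cong (λ z → u - v - z) (sym (ψv sv))) st
         in (nz , from (linearise su sv sw′ st′) eq) , su , sv , sw′ , st′ })
    where
    μ : Bit → Carrier
    μ k = multiplier k a b
    ψu : SqIdx F i u → ψ a b u ≡ μ i * u
    ψu = ψ-multiplier i
    ψv : SqIdx F j (- v) → ψ a b (- v) ≡ μ j * (- v)
    ψv = ψ-multiplier j
    linearise : SqIdx F i u → SqIdx F j (- v) →
      SqIdx F r (ψ a b u - v) → SqIdx F s (u - v - ψ a b (- v)) →
      (ψ a b (ψ a b u - v) ≡ ψ a b (- v) + ψ a b (u - v - ψ a b (- v)))
      ⇔ (μ r * (μ i * u - v) ≡ μ j * (- v) + μ s * (u - v - μ j * (- v)))
    linearise su sv sw st = mk⇔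
      (λ eq → trans (sym lhs) (trans eq rhs))
      (λ eq → trans lhs (trans eq (sym rhs)))
      where
      lhs : ψ a b (ψ a b u - v) ≡ μ r * (μ i * u - v)
      lhs = trans (ψ-multiplier r sw) (cong (λ z → μ r * (z - v)) (ψu su))
      rhs : ψ a b (- v) + ψ a b (u - v - ψ a b (- v)) ≡ μ j * (- v) + μ s * (u - v - μ j * (- v))
      rhs = trans (cong₂ _+_ (ψv sv) (ψ-multiplier s st))
                  (cong (λ z → μ j * (- v) + μ s * (u - v - z)) (ψv sv))

  E₀₁⁰⁰-empty : ∀ {a b u v} → IsSquare (- 1#) → InΣ a b → ¬ InLinEijrs b0 b1 b0 b0 a b u v
  E₀₁⁰⁰-empty {a} {b} {u} {v} -1-square σ (_ , u-square , -v-nonsquare , _ , _ , eq) =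
    -v-nonsquare (to (square-*⇔ (b , refl) (*-≢0 b≢0 b≢0))
      (subst IsSquare (sym b²[-v]≡-ab*u) (square-* (square-* -1-square ab-sq) u-square)))
    where
    open InΣ σ
    au≡bv : a * u ≡ b * v
    au≡bv = x-y≡0⇒x≡y (x*y≡0⇒y≡0 (x≢y⇒x-y≢0 a≢1) (linear-combination₁ 1# eq
      (solve 4 (λ a b u v →
          (a :- :1) :* (a :* u :- b :* v) :- :0
        := :1 :* (a :* (a :* u :- v) :- (b :* (:- v) :+ a :* (u :- v :- b :* (:- v)))))
        refl a b u v)))
    b²[-v]≡-ab*u : b * b * (- v) ≡ - 1# * (a * b) * u
    b²[-v]≡-ab*u = linear-combination₁ b au≡bv
      (solve 4 (λ a b u v →
          b :* b :* (:- v) :- :- :1 :* (a :* b) :* u := b :* (a :* u :- b :* v))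
        refl a b u v)

  E₀₁¹⁰-empty : ∀ {a b u v} → IsSquare (- 1#) → InΣ a b → ¬ InLinEijrs b0 b1 b1 b0 a b u v
  E₀₁¹⁰-empty {a} {b} {u} {v} -1-square σ (_ , u-square , -v-nonsquare , _ , _ , eq) =
    -v-nonsquare (subst IsSquare (sym -v≡-1*u) (square-* -1-square u-square))
    where
    open InΣ σ
    u≡v : u ≡ v
    u≡v = x-y≡0⇒x≡y (x*y≡0⇒y≡0 (*-≢0 a≢0 (x≢y⇒x-y≢0 b≢1)) (linear-combination₁ 1# eq
      (solve 4 (λ a b u v →
          a :* (b :- :1) :* (u :- v) :- :0
        := :1 :* (b :* (a :* u :- v) :- (b :* (:- v) :+ a :* (u :- v :- b :* (:- v)))))
        refl a b u v)))
    -v≡-1*u : - v ≡ - 1# * u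
    -v≡-1*u = linear-combination₁ 1# u≡v
      (solve 2 (λ u v → :- v :- :- :1 :* u := :1 :* (u :- v)) refl u v)

  E₀₀⁰⁰-equation⇔ : ∀ {a u v} → a ≢ 0# → a ≢ 1# →
    (a * (a * u - v) ≡ a * (- v) + a * (u - v - a * (- v))) ⇔ u ≡ v
  E₀₀⁰⁰-equation⇔ {a} {u} {v} a≢0 a≢1 = mk⇔
    (λ eq → x-y≡0⇒x≡y (x*y≡0⇒y≡0 (*-≢0 a≢0 (x≢y⇒x-y≢0 a≢1))
      (linear-combination₁ 1# eq (solve 3 (λ a u v → a :* (a :- :1) :* (u :- v) :- :0
        := :1 :* (a :* (a :* u :- v) :- (a :* (:- v) :+ a :* (u :- v :- a :* (:- v)))))
        refl a u v))))
    (λ u≡v → linear-combination₁ (a * (a - 1#)) u≡v (solve 3 (λ a u v →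
        a :* (a :* u :- v) :- (a :* (:- v) :+ a :* (u :- v :- a :* (:- v)))
      := a :* (a :- :1) :* (u :- v)) refl a u v))

  E₀₀⁰⁰⇔ : ∀ {a b} → IsSquare (- 1#) → InΣ a b →
    ∃₂ (InLinEijrs b0 b0 b0 b0 a b) ⇔ (IsSquare (a - 1#) × IsSquare a)
  E₀₀⁰⁰⇔ {a} {b} -1-square σ = mk⇔
    (λ { (u , v , nz , u-square , _ , sw , st , eq) →
         signs u-square nz sw st (to (E₀₀⁰⁰-equation⇔ a≢0 a≢1) eq) })
    (λ { (a-1-square , a-square) →
         1# , 1# , (λ { (1≡0 , _) → 1≢0 1≡0 }) , square-1 , -1-square
            , subst IsSquare (solve 1 (λ a → a :- :1 := a :* :1 :- :1) refl a) a-1-square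
            , subst IsSquare (solve 1 (λ a → a := :1 :- :1 :- a :* (:- :1)) refl a) a-square
            , from (E₀₀⁰⁰-equation⇔ a≢0 a≢1) refl })
    where
    open InΣ σ
    signs : ∀ {u v} → IsSquare u → ¬ (u ≡ 0# × v ≡ 0#) →
      IsSquare (a * u - v) → IsSquare (u - v - a * (- v)) → u ≡ v →
      IsSquare (a - 1#) × IsSquare a
    signs {u} u-square nz sw st refl =
        to (square-*⇔ u-square u≢0)
          (subst IsSquare (solve 2 (λ a u → a :* u :- u := u :* (a :- :1)) refl a u) sw)
      , to (square-*⇔ u-square u≢0)
          (subst IsSquare (solve 2 (λ a u → u :- u :- a :* (:- u) := u :* a) refl a u) st)
      where
      u≢0 : u ≢ 0#
      u≢0 u≡0 = nz (u≡0 , u≡0)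

  P₁ P₂ : Carrier → Carrier → Carrier
  P₁ x y = x * x * y + x * y - x * x - y * y
  P₂ x y = x * y * y + x * y - x * x - y * y

  Ψ⁻¹-b : Carrier → Carrier → Carrier
  Ψ⁻¹-b x y = (y - 1#) / (y - x)

  module _ {x y : Carrier} (S : InS x y) where
    open InS S

    y-x≢0 : y - x ≢ 0#
    y-x≢0 y-x≡0 = x≢y (sym (x-y≡0⇒x≡y y-x≡0))

    y-1≢0 : y - 1# ≢ 0#
    y-1≢0 = x≢y⇒x-y≢0 y≢1

    Ψ⁻¹-b-spec : Ψ⁻¹-b x y * (y - x) ≡ y - 1#
    Ψ⁻¹-b-spec = x/y*y≡x (y - 1#) y-x≢0

    Ψ-fibre : ∀ {a b} → InΣ a b → Ψ (a , b) ≡ (x , y) → a ≡ x * Ψ⁻¹-b x y × b ≡ Ψ⁻¹-b x y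
    Ψ-fibre {a} {b} σ Ψab≡xy = trans a≡xb (cong (x *_) b≡Ψ⁻¹-b) , b≡Ψ⁻¹-b
      where
      open InΣ σ using (b≢0; b≢1)
      a≡xb : a ≡ x * b
      a≡xb = trans (sym (x/y*y≡x a b≢0)) (cong (_* b) (cong proj₁ Ψab≡xy))
      1-a≡y[1-b] : 1# - a ≡ y * (1# - b)
      1-a≡y[1-b] = trans (sym (x/y*y≡x (1# - a) (x≢y⇒x-y≢0 (λ 1≡b → b≢1 (sym 1≡b)))))
                         (cong (_* (1# - b)) (cong proj₂ Ψab≡xy))
      b[y-x]≡y-1 : b * (y - x) ≡ y - 1#
      b[y-x]≡y-1 = linear-combination₂ 1# 1# a≡xb 1-a≡y[1-b] (solve 4 (λ a b x y →
          b :* (y :- x) :- (y :- :1)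
        := :1 :* (a :- x :* b) :+ :1 :* ((:1 :- a) :- y :* (:1 :- b)))
        refl a b x y)
      b≡Ψ⁻¹-b : b ≡ Ψ⁻¹-b x y
      b≡Ψ⁻¹-b = trans (sym (x*y/y≡x b y-x≢0)) (cong (_/ (y - x)) b[y-x]≡y-1)

    module _ {b : Carrier} (b[y-x]≡y-1 : b * (y - x) ≡ y - 1#) where

      1-xb≡y[1-b] : 1# - x * b ≡ y * (1# - b)
      1-xb≡y[1-b] = linear-combination₁ 1# b[y-x]≡y-1 (solve 3 (λ x y b →
          (:1 :- x :* b) :- y :* (:1 :- b) := :1 :* (b :* (y :- x) :- (y :- :1)))
        refl x y b)

      b≢0 : b ≢ 0#
      b≢0 b≡0 = y-1≢0 (trans (sym b[y-x]≡y-1) (trans (cong (_* (y - x)) b≡0) (zeroˡ _)))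

      b≢1 : b ≢ 1#
      b≢1 b≡1 = x≢1 (linear-combination₁ (- 1#) (subst (λ z → z * (y - x) ≡ y - 1#) b≡1 b[y-x]≡y-1)
        (solve 2 (λ x y → x :- :1 := :- :1 :* (:1 :* (y :- x) :- (y :- :1))) refl x y))

      1-b≢0 : 1# - b ≢ 0#
      1-b≢0 = x≢y⇒x-y≢0 (λ 1≡b → b≢1 (sym 1≡b))

      Σ-of-Ψ⁻¹ : InΣ (x * b) b
      Σ-of-Ψ⁻¹ = record
        { a≢b       = λ xb≡b → x≢1 (x-y≡0⇒x≡y (x*y≡0⇒y≡0 b≢0 (linear-combination₁ 1# xb≡b
                        (solve 2 (λ x b → b :* (x :- :1) :- :0 := :1 :* (x :* b :- b))
                          refl x b))))
        ; a≢0       = *-≢0 x≢0 b≢0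
        ; a≢1       = λ xb≡1 → *-≢0 y≢0 1-b≢0 (trans (sym 1-xb≡y[1-b])
                        (trans (cong (λ z → 1# - z) xb≡1) (-‿inverseʳ 1#)))
        ; b≢0       = b≢0
        ; b≢1       = b≢1
        ; ab-sq     = subst IsSquare (sym (*-assoc x b b)) (square-* x-sq (b , refl))
        ; 1-a1-b-sq = subst IsSquare
                        (trans (sym (*-assoc y _ _)) (cong (_* (1# - b)) (sym 1-xb≡y[1-b])))
                        (square-* y-sq (1# - b , refl))
        }

      Ψ-Ψ⁻¹ : Ψ (x * b , b) ≡ (x , y)
      Ψ-Ψ⁻¹ = cong₂ _,_ (x*y/y≡x x b≢0)
                        (trans (cong (_/ (1# - b)) 1-xb≡y[1-b]) (x*y/y≡x y 1-b≢0))

      xb-square⇔ : IsSquare (- 1#) → IsSquare (x * b) ⇔ IsSquare ((1# - y) * (y - x))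
      xb-square⇔ -1-square = square-factors⇔ product
        (square-* (square-* -1-square x-sq) (y - 1# , refl))
        (*-≢0 (*-≢0 -1≢0 x≢0) (*-≢0 y-1≢0 y-1≢0))
        where
        product : x * b * ((1# - y) * (y - x)) ≡ - 1# * x * ((y - 1#) * (y - 1#))
        product = linear-combination₁ (x * (1# - y)) b[y-x]≡y-1 (solve 3 (λ x y b →
            x :* b :* ((:1 :- y) :* (y :- x)) :- :- :1 :* x :* ((y :- :1) :* (y :- :1))
          := x :* (:1 :- y) :* (b :* (y :- x) :- (y :- :1)))
          refl x y b)

      xb-1-square⇔ : IsSquare (- 1#) → IsSquare (x * b - 1#) ⇔ IsSquare ((1# - x) * (y - x))
      xb-1-square⇔ -1-square = square-factors⇔ product
        (square-* (square-* -1-square y-sq) (1# - x , refl))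
        (*-≢0 (*-≢0 -1≢0 y≢0) (*-≢0 1-x≢0 1-x≢0))
        where
        1-x≢0 : 1# - x ≢ 0#
        1-x≢0 = x≢y⇒x-y≢0 (λ 1≡x → x≢1 (sym 1≡x))
        product : (x * b - 1#) * ((1# - x) * (y - x)) ≡ - 1# * y * ((1# - x) * (1# - x))
        product = linear-combination₁ ((1# - x) * x) b[y-x]≡y-1 (solve 3 (λ x y b →
            (x :* b :- :1) :* ((:1 :- x) :* (y :- x)) :- :- :1 :* y :* ((:1 :- x) :* (:1 :- x))
          := (:1 :- x) :* x :* (b :* (y :- x) :- (y :- :1)))
          refl x y b)

      E₀₀¹¹-equation⇔ : ∀ {u v} →
        (b * (x * b * u - v) ≡ x * b * (- v) + b * (u - v - x * b * (- v))) ⇔ x * v ≡ y * u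
      E₀₀¹¹-equation⇔ {u} {v} = mk⇔
        (λ eq → sym (x-y≡0⇒x≡y (x*y≡0⇒y≡0 (*-≢0 b≢0 (x≢y⇒x-y≢0 b≢1))
          (linear-combination₂ 1# (b * u) eq b[y-x]≡y-1 (solve 5 (λ x y b u v →
              b :* (b :- :1) :* (y :* u :- x :* v) :- :0
            := :1 :* (b :* (x :* b :* u :- v)
                      :- (x :* b :* (:- v) :+ b :* (u :- v :- x :* b :* (:- v))))
               :+ b :* u :* (b :* (y :- x) :- (y :- :1)))
            refl x y b u v)))))
        (λ xv≡yu → linear-combination₂ (- (b * (b - 1#))) (- (b * u)) xv≡yu b[y-x]≡y-1
          (solve 5 (λ x y b u v →
              b :* (x :* b :* u :- v) :- (x :* b :* (:- v) :+ b :* (u :- v :- x :* b :* (:- v)))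
            := :- (b :* (b :- :1)) :* (x :* v :- y :* u)
               :+ :- (b :* u) :* (b :* (y :- x) :- (y :- :1)))
            refl x y b u v))

      E₀₀¹¹-nonsquares : ∀ {u v} → IsSquare u → u ≢ 0# → x * v ≡ y * u →
        (IsNonsquare (x * b * u - v) × IsNonsquare (u - v - x * b * (- v)))
        ⇔ (IsNonsquare (P₁ x y * (y - x)) × IsNonsquare (P₂ x y * (y - x)))
      E₀₀¹¹-nonsquares {u} {v} u-square u≢0 xv≡yu =
            ¬-cong-⇔ (square-scaled⇔ first Q-square Q≢0 u-square u≢0)
        ×-⇔ ¬-cong-⇔ (square-scaled⇔ second Q-square Q≢0 u-square u≢0)
        where
        Q-square : IsSquare (x * ((y - x) * (y - x)))
        Q-square = square-* x-sq (y - x , refl)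
        Q≢0 : x * ((y - x) * (y - x)) ≢ 0#
        Q≢0 = *-≢0 x≢0 (*-≢0 y-x≢0 y-x≢0)
        first : x * ((y - x) * (y - x)) * (x * b * u - v) ≡ u * (P₁ x y * (y - x))
        first = linear-combination₂ (- ((y - x) * (y - x))) ((y - x) * x * x * u) xv≡yu b[y-x]≡y-1
          (solve 5 (λ x y b u v →
              x :* ((y :- x) :* (y :- x)) :* (x :* b :* u :- v)
                :- u :* ((x :* x :* y :+ x :* y :- x :* x :- y :* y) :* (y :- x))
            := :- ((y :- x) :* (y :- x)) :* (x :* v :- y :* u)
                :+ (y :- x) :* x :* x :* u :* (b :* (y :- x) :- (y :- :1)))
            refl x y b u v)
        second : x * ((y - x) * (y - x)) * (u - v - x * b * (- v)) ≡ u * (P₂ x y * (y - x))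
        second = linear-combination₂ ((y - x) * (y - x) * (x * b - 1#)) ((y - x) * x * y * u)
          xv≡yu b[y-x]≡y-1
          (solve 5 (λ x y b u v →
              x :* ((y :- x) :* (y :- x)) :* (u :- v :- x :* b :* (:- v))
                :- u :* ((x :* y :* y :+ x :* y :- x :* x :- y :* y) :* (y :- x))
            := (y :- x) :* (y :- x) :* (x :* b :- :1) :* (x :* v :- y :* u)
                :+ (y :- x) :* x :* y :* u :* (b :* (y :- x) :- (y :- :1)))
            refl x y b u v)

      E₀₀¹¹⇔ : IsSquare (- 1#) → ∃₂ (InLinEijrs b0 b0 b1 b1 (x * b) b) ⇔
        (IsNonsquare (P₁ x y * (y - x)) × IsNonsquare (P₂ x y * (y - x)))
      E₀₀¹¹⇔ -1-square = mk⇔ nonsquares witness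
        where
        nonsquares : ∃₂ (InLinEijrs b0 b0 b1 b1 (x * b) b) →
          IsNonsquare (P₁ x y * (y - x)) × IsNonsquare (P₂ x y * (y - x))
        nonsquares (u , v , nz , u-square , _ , sw , st , eq) =
          to (E₀₀¹¹-nonsquares u-square u≢0 xv≡yu) (sw , st)
          where
          xv≡yu : x * v ≡ y * u
          xv≡yu = to E₀₀¹¹-equation⇔ eq
          u≢0 : u ≢ 0#
          u≢0 u≡0 = nz (u≡0 , x*y≡0⇒y≡0 x≢0 (trans xv≡yu (trans (cong (y *_) u≡0) (zeroʳ y))))

        x[y/x]≡y*1 : x * (y / x) ≡ y * 1#
        x[y/x]≡y*1 = begin
          x * (y * x ⁻¹)  ≡⟨ solve 3 (λ x y x⁻¹ → x :* (y :* x⁻¹) := y :* x :* x⁻¹)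
                               refl x y (x ⁻¹) ⟩
          (y * x) / x     ≡⟨ x*y/y≡x y x≢0 ⟩
          y               ≡⟨ *-identityʳ y ⟨
          y * 1#          ∎

        -y/x-square : IsSquare (- (y / x))
        -y/x-square = subst IsSquare
          (solve 2 (λ y x⁻¹ → :- :1 :* (y :* x⁻¹) := :- (y :* x⁻¹)) refl y (x ⁻¹))
          (square-* -1-square (square-* y-sq (square-⁻¹ x-sq x≢0)))

        witness : IsNonsquare (P₁ x y * (y - x)) × IsNonsquare (P₂ x y * (y - x)) →
          ∃₂ (InLinEijrs b0 b0 b1 b1 (x * b) b)
        witness ns = extend (from (E₀₀¹¹-nonsquares square-1 1≢0 x[y/x]≡y*1) ns)
          where
          extend : IsNonsquare (x * b * 1# - y / x)
                 × IsNonsquare (1# - y / x - x * b * (- (y / x))) →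
            ∃₂ (InLinEijrs b0 b0 b1 b1 (x * b) b)
          extend (sw , st) = 1# , y / x , (λ { (1≡0 , _) → 1≢0 1≡0 }) , square-1 , -y/x-square
                           , sw , st , from E₀₀¹¹-equation⇔ x[y/x]≡y*1

    InSijrs⇔ : ∀ {i j r s} →
      InSijrs F i j r s x y ⇔ ∃₂ (InLinEijrs i j r s (x * Ψ⁻¹-b x y) (Ψ⁻¹-b x y))
    InSijrs⇔ = mk⇔
      (λ { (_ , _ , (σ , _ , _ , e) , Ψab≡xy) → fibre-E (Ψ-fibre σ Ψab≡xy) e })
      (λ { (u , v , e) → x * Ψ⁻¹-b x y , Ψ⁻¹-b x y
                       , (Σ-of-Ψ⁻¹ Ψ⁻¹-b-spec , u , v , from InEijrs⇔InLinEijrs e)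
                       , Ψ-Ψ⁻¹ Ψ⁻¹-b-spec })
      where
      fibre-E : ∀ {i j r s a b u v} → a ≡ x * Ψ⁻¹-b x y × b ≡ Ψ⁻¹-b x y →
        InEijrs F i j r s a b u v → ∃₂ (InLinEijrs i j r s (x * Ψ⁻¹-b x y) (Ψ⁻¹-b x y))
      fibre-E {u = u} {v} (refl , refl) e = u , v , to InEijrs⇔InLinEijrs e

    S₀₀⁰⁰⇔ : IsSquare (- 1#) → InSijrs F b0 b0 b0 b0 x y ⇔
      (IsSquare ((1# - x) * (y - x)) × IsSquare ((1# - y) * (y - x)))
    S₀₀⁰⁰⇔ -1-square = ⇔-trans InSijrs⇔ (⇔-trans (E₀₀⁰⁰⇔ -1-square (Σ-of-Ψ⁻¹ Ψ⁻¹-b-spec))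
      (xb-1-square⇔ Ψ⁻¹-b-spec -1-square ×-⇔ xb-square⇔ Ψ⁻¹-b-spec -1-square))

    S₀₀¹¹⇔ : IsSquare (- 1#) → InSijrs F b0 b0 b1 b1 x y ⇔
      (IsNonsquare (P₁ x y * (y - x)) × IsNonsquare (P₂ x y * (y - x)))
    S₀₀¹¹⇔ -1-square = ⇔-trans InSijrs⇔ (E₀₀¹¹⇔ Ψ⁻¹-b-spec -1-square)

  S₀₁⁰⁰-empty : IsSquare (- 1#) → ∀ x y → ¬ InSijrs F b0 b1 b0 b0 x y
  S₀₁⁰⁰-empty -1-square _ _ (_ , _ , (σ , _ , _ , e) , _) =
    E₀₁⁰⁰-empty -1-square σ (to InEijrs⇔InLinEijrs e)

  S₀₁¹⁰-empty : IsSquare (- 1#) → ∀ x y → ¬ InSijrs F b0 b1 b1 b0 x y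
  S₀₁¹⁰-empty -1-square _ _ (_ , _ , (σ , _ , _ , e) , _) =
    E₀₁¹⁰-empty -1-square σ (to InEijrs⇔InLinEijrs e)

lemma2p4 : ∀ {c : Level} (F : FiniteField c) →
    let open FiniteField F in
    OddChar → IsSquare (- 1#) →
      (∀ x y → ¬ InSijrs F b0 b1 b0 b0 x y)
    × (∀ x y → ¬ InSijrs F b0 b1 b1 b0 x y)
    × (∀ x y → InS x y →
         InSijrs F b0 b0 b0 b0 x y ⇔
           (IsSquare ((1# - x) * (y - x)) × IsSquare ((1# - y) * (y - x))))
    × (∀ x y → InS x y →
         InSijrs F b0 b0 b1 b1 x y ⇔
           (IsNonsquare ((x * x * y + x * y - x * x - y * y) * (y - x))
            × IsNonsquare ((x * y * y + x * y - x * x - y * y) * (y - x))))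
lemma2p4 F _ -1-square =
    S₀₁⁰⁰-empty F -1-square
  , S₀₁¹⁰-empty F -1-square
  , (λ _ _ S → S₀₀⁰⁰⇔ F S -1-square)
  , (λ _ _ S → S₀₀¹¹⇔ F S -1-square)
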